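{- Let $G$ be a finite connected graph with vertex set $V$ and let $t\in V$. Let $U$ be an independent set in $G$, and define $U':=\{x\in U: d(x,t)\ge 2\}$, $W:=V\setminus U$ and $d:=\max_{x\in V}d(x,t)$. If $|U'|>(d-1)|W|$, then $G$ is not $t$-stackable.
   Context: Cup stacking on a finite connected graph $G$: initially one cup on every vertex; a move takes all $r\ge1$ cups from a vertex $x$ onto a vertex $y\neq x$ that already carries at least one cup and satisfies $d(x,y)=r$ (shortest-path distance in $G$). $G$ is $t$-stackable if some sequence of moves ends with all cups on $t$. -}

module Defs where

open import Data.Nat using (ℕ; zero; suc; _+_; _≤_)
open import Data.Fin using (Fin)
open import Data.Bool using (Bool; true; false)
open import Data.Product using (Σ; ∃; _×_; _,_)
open import Relation.Binary.PropositionalEquality using (_≡_; _≢_)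
open import Relation.Binary.Construct.Closure.ReflexiveTransitive using (Star)

record Graph (n : ℕ) : Set where
  field
    adj   : Fin n → Fin n → Bool
    sym   : ∀ x y → adj x y ≡ adj y x
    irrfl : ∀ x → adj x x ≡ false
open Graph public

module _ {n : ℕ} (G : Graph n) where

  data Walk : Fin n → Fin n → ℕ → Set where
    here : ∀ {x} → Walk x x 0
    step : ∀ {x z y k} → adj G x z ≡ true → Walk z y k → Walk x y (suc k)

  Dist : Fin n → Fin n → ℕ → Set
  Dist x y r = Walk x y r × (∀ m → Walk x y m → r ≤ m)

  Connected : Set
  Connected = ∀ x y → ∃ λ k → Walk x y k

  -- A configuration of cups: number of cups on each vertex.
  Config : Set
  Config = Fin n → ℕ

  Move : Config → Config → Set
  Move c c′ = Σ (Fin n) λ x → Σ (Fin n) λ y →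
      x ≢ y × 1 ≤ c x × 1 ≤ c y × Dist x y (c x)
    × c′ x ≡ 0 × c′ y ≡ c y + c x
    × (∀ z → z ≢ x → z ≢ y → c′ z ≡ c z)

  initial : Config
  initial _ = 1

  Stackable : Fin n → Set
  Stackable t = ∃ λ c → Star Move initial c × (∀ z → z ≢ t → c z ≡ 0)

{-# OPTIONS --safe #-}
module Submission where

-- Let every cup remember its starting vertex, and let w z and u z count the cups at z
-- that started in W = ∁ U and in U′.  Away from t, a nonempty stack with no cup from W
-- is a single cup that has never moved from its vertex of U: merging two such cups would
-- need them at distance 1, which independence of U forbids.  A stack jumping onto t from
-- x consists of c x = d(x,t) ≤ d cups; if k ≥ 1 of them come from W it brings at most
-- d - 1 ≤ (d - 1) k cups from U′, and if none do it is a lone cup at distance 1 from t,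
-- hence not in U′.  So u t ≤ (d - 1) w t is preserved, and once all cups are on t it reads
-- |U′| ≤ (d - 1) |W|.  A move off t itself empties t for good, so stacking then fails.

open import Defs hiding (sym)
open import Data.Bool using (false; true; if_then_else_)
open import Data.Empty using (⊥; ⊥-elim)
open import Data.Fin using (Fin; _≟_)
open import Data.Fin.Properties using (punchInᵢ≢i)
open import Data.Fin.Subset using (Subset; _∈_; _∉_; ∁; ∣_∣; inside; outside)
open import Data.Fin.Subset.Properties using (_∈?_; x∈∁p⇒x∉p; x∉∁p⇒x∈p)
open import Data.Nat using (ℕ; zero; suc; _+_; _*_; _∸_; _≤_; _<_; z≤n; s≤s; NonZero)
open import Data.Nat.Properties
  using ( +-0-commutativeMonoid; +-identityʳ; +-comm; +-assoc; +-cancelʳ-≡; *-distribˡ-+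
        ; m+n≡0⇒m≡0; m+n≡0⇒n≡0; ≤-refl; ≤-reflexive; ≤-trans; ≤-antisym; n≤0⇒n≡0; n≮0
        ; >⇒≢; <⇒≱; +-mono-≤; m≤m+n; ∸-monoʳ-≤; m≤m*n; m+n≤o⇒m≤o∸n; module ≤-Reasoning)
open import Algebra.Properties.CommutativeMonoid.Sum +-0-commutativeMonoid
  using (sum; sum-remove; sum-cong-≗; sum-replicate-zero)
open import Data.Nat.Tactic.RingSolver using (solve-∀)
open import Data.Product using (∃; _×_; _,_; proj₁)
open import Data.Sum using (_⊎_; inj₁; inj₂)
open import Data.Vec using ([]; _∷_)
open import Data.Vec.Functional using (Vector; updateAt; removeAt)
open import Data.Vec.Functional.Properties using (updateAt-updates; updateAt-minimal)
open import Function using (const; _∘_)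
open import Function.Bundles using (_⇔_; Equivalence)
open import Relation.Binary.Construct.Closure.ReflexiveTransitive using (Star; ε; _◅_)
open import Relation.Binary.PropositionalEquality
  using (_≡_; _≢_; refl; sym; trans; cong; cong₂; subst; subst₂; module ≡-Reasoning)
open import Relation.Nullary using (¬_; yes; no; does; contradiction)

sum-exchange : ∀ {n} {f g : Vector ℕ n} x → (∀ z → z ≢ x → f z ≡ g z) →
               sum f + g x ≡ sum g + f x
sum-exchange {suc _} {f} {g} x agree = begin
  sum f + g x                        ≡⟨ cong (_+ g x) (sum-remove {i = x} f) ⟩
  f x + sum (removeAt f x) + g x     ≡⟨ cong (λ s → f x + s + g x) (sum-cong-≗ (λ j → agree _ (punchInᵢ≢i x j))) ⟩
  f x + sum (removeAt g x) + g x     ≡⟨ swap-outer (f x) _ (g x) ⟩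
  g x + sum (removeAt g x) + f x     ≡⟨ cong (_+ f x) (sym (sum-remove {i = x} g)) ⟩
  sum g + f x                        ∎
  where
  open ≡-Reasoning
  swap-outer : ∀ a s b → a + s + b ≡ b + s + a
  swap-outer = solve-∀

sum-supported-at : ∀ {n} {f : Vector ℕ n} x → (∀ z → z ≢ x → f z ≡ 0) → sum f ≡ f x
sum-supported-at {n} {f} x vanish = begin
  sum f                    ≡⟨ sym (+-identityʳ (sum f)) ⟩
  sum f + 0                ≡⟨ sum-exchange x vanish ⟩
  sum {n} (const 0) + f x  ≡⟨ cong (_+ f x) (sum-replicate-zero n) ⟩
  f x                      ∎
  where open ≡-Reasoning

sum-updateAt : ∀ {n} (f : Vector ℕ n) x (g : ℕ → ℕ) →
               sum (updateAt f x g) + f x ≡ sum f + g (f x)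
sum-updateAt f x g = begin
  sum (updateAt f x g) + f x        ≡⟨ sum-exchange x (λ z z≢x → updateAt-minimal z x f z≢x) ⟩
  sum f + updateAt f x g x          ≡⟨ cong (sum f +_) (updateAt-updates x f) ⟩
  sum f + g (f x)                   ∎
  where open ≡-Reasoning

module _ {n : ℕ} where

  -- Move G c c′ unfolds to  x , y , side conditions , Transfer x y c c′.
  Transfer : Fin n → Fin n → Vector ℕ n → Vector ℕ n → Set
  Transfer x y f f′ = f′ x ≡ 0 × f′ y ≡ f y + f x × (∀ z → z ≢ x → z ≢ y → f′ z ≡ f z)

  transfer : Fin n → Fin n → Vector ℕ n → Vector ℕ n
  transfer x y f = updateAt (updateAt f x (const 0)) y (_+ f x)

  module _ {x y : Fin n} (f : Vector ℕ n) where

    transfer-source : x ≢ y → transfer x y f x ≡ 0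
    transfer-source x≢y = trans (updateAt-minimal x y _ x≢y) (updateAt-updates x f)

    transfer-target : x ≢ y → transfer x y f y ≡ f y + f x
    transfer-target x≢y = trans (updateAt-updates y _) (cong (_+ f x) (updateAt-minimal y x f (x≢y ∘ sym)))

    transfer-others : ∀ z → z ≢ x → z ≢ y → transfer x y f z ≡ f z
    transfer-others z z≢x z≢y = trans (updateAt-minimal z y _ z≢y) (updateAt-minimal z x f z≢x)

    transfer-Transfer : x ≢ y → Transfer x y f (transfer x y f)
    transfer-Transfer x≢y = transfer-source x≢y , transfer-target x≢y , transfer-others

  sum-transfer : ∀ x y (f : Vector ℕ n) → sum (transfer x y f) ≡ sum f
  sum-transfer x y f = +-cancelʳ-≡ (h y) _ _ (begin
    sum (transfer x y f) + h y   ≡⟨ sum-updateAt h y (_+ f x) ⟩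
    sum h + (h y + f x)          ≡⟨ cong (sum h +_) (+-comm (h y) (f x)) ⟩
    sum h + (f x + h y)          ≡⟨ sym (+-assoc (sum h) (f x) (h y)) ⟩
    sum h + f x + h y            ≡⟨ cong (_+ h y) (sum-updateAt f x (const 0)) ⟩
    sum f + 0 + h y              ≡⟨ cong (_+ h y) (+-identityʳ (sum f)) ⟩
    sum f + h y                  ∎)
    where
    open ≡-Reasoning
    h : Vector ℕ n
    h = updateAt f x (const 0)

  Transfer-+ : ∀ {x y f f′ g g′} → Transfer x y f f′ → Transfer x y g g′ →
               Transfer x y (λ z → f z + g z) (λ z → f′ z + g′ z)
  Transfer-+ {x} {y} {f} {g = g} (f′x , f′y , f′z) (g′x , g′y , g′z) =
      cong₂ _+_ f′x g′x
    , trans (cong₂ _+_ f′y g′y) (interchange (f y) (f x) (g y) (g x))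
    , λ z z≢x z≢y → cong₂ _+_ (f′z z z≢x z≢y) (g′z z z≢x z≢y)
    where
    interchange : ∀ a b c d → (a + b) + (c + d) ≡ (a + c) + (b + d)
    interchange = solve-∀

  Transfer-mono-≤ : ∀ {x y f f′ g g′} → (∀ z → f z ≤ g z) →
                    Transfer x y f f′ → Transfer x y g g′ → ∀ z → f′ z ≤ g′ z
  Transfer-mono-≤ {x} {y} f≤g (f′x , f′y , f′z) (_ , g′y , g′z) z with z ≟ x | z ≟ y
  ... | yes refl | _     = subst (_≤ _) (sym f′x) z≤n
  ... | no _ | yes refl  = subst₂ _≤_ (sym f′y) (sym g′y) (+-mono-≤ (f≤g y) (f≤g x))
  ... | no z≢x | no z≢y  = subst₂ _≤_ (sym (f′z z z≢x z≢y)) (sym (g′z z z≢x z≢y)) (f≤g z)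

indicator : ∀ {n} → Subset n → Vector ℕ n
indicator p z = if does (z ∈? p) then 1 else 0

sum-indicator : ∀ {n} (p : Subset n) → sum (indicator p) ≡ ∣ p ∣
sum-indicator []            = refl
sum-indicator (inside ∷ p)  = cong suc (sum-indicator p)
sum-indicator (outside ∷ p) = sum-indicator p

module _ {n : ℕ} (G : Graph n) where

  Dist-refl : ∀ {x} → Dist G x x 0
  Dist-refl = here , λ _ _ → z≤n

  Dist-unique : ∀ {x y r s} → Dist G x y r → Dist G x y s → r ≡ s
  Dist-unique (walk-r , min-r) (walk-s , min-s) = ≤-antisym (min-r _ walk-s) (min-s _ walk-r)

  walk₁⇒adj : ∀ {x y} → Walk G x y 1 → adj G x y ≡ true
  walk₁⇒adj (step x~y here) = x~y

  Move-keeps-empty : ∀ {c c′ z} → Move G c c′ → c z ≡ 0 → c′ z ≡ 0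
  Move-keeps-empty {z = z} (x , y , _ , _ , 1≤cy , _ , c′x , _ , c′z) cz≡0 with z ≟ x | z ≟ y
  ... | yes refl | _     = c′x
  ... | no _ | yes refl  = contradiction cz≡0 (>⇒≢ 1≤cy)
  ... | no z≢x | no z≢y  = trans (c′z z z≢x z≢y) cz≡0

  Move-target-nonempty : ∀ {c c′} → Move G c c′ → ∃ λ y → 1 ≤ c′ y
  Move-target-nonempty {c} (_ , y , _ , _ , 1≤cy , _ , _ , c′y , _) =
    y , subst (1 ≤_) (sym c′y) (≤-trans 1≤cy (m≤m+n (c y) _))

m+n≤o⇒m≤[o∸1]*n : ∀ m n o .{{_ : NonZero n}} → m + n ≤ o → m ≤ (o ∸ 1) * n
m+n≤o⇒m≤[o∸1]*n m n@(suc _) o m+n≤o = begin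
  m            ≤⟨ m+n≤o⇒m≤o∸n m m+n≤o ⟩
  o ∸ n        ≤⟨ ∸-monoʳ-≤ o (s≤s z≤n) ⟩
  o ∸ 1        ≤⟨ m≤m*n (o ∸ 1) n ⟩
  (o ∸ 1) * n  ∎
  where open ≤-Reasoning

module _ {n : ℕ} (G : Graph n) (t : Fin n)
    (U : Subset n) (U-independent : ∀ x y → x ∈ U → y ∈ U → adj G x y ≡ false)
    (U′ : Subset n) (U′-far : ∀ x → x ∈ U′ → x ∈ U × ∃ λ r → Dist G x t r × 2 ≤ r)
    (d : ℕ) (d-bound : ∀ x r → Dist G x t r → r ≤ d) where

  U′-dist : ∀ {x r} → x ∈ U′ → Dist G x t r → 2 ≤ r
  U′-dist x∈U′ dist with U′-far _ x∈U′
  ... | _ , _ , dist′ , 2≤r = subst (2 ≤_) (Dist-unique G dist′ dist) 2≤r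

  t∉U′ : t ∉ U′
  t∉U′ t∈U′ = n≮0 (U′-dist t∈U′ (Dist-refl G))

  LoneCup : Fin n → ℕ → ℕ → ℕ → Set
  LoneCup z cz wz uz = 1 ≤ cz → wz ≡ 0 → cz ≡ 1 × z ∈ U × (uz ≡ 0 ⊎ z ∈ U′)

  record Invariant (c : Config G) : Set where
    field
      w u         : Vector ℕ n
      tokens≤cups : ∀ z → w z + u z ≤ c z
      lone-cup    : ∀ z → z ≢ t → LoneCup z (c z) (w z) (u z)
      bound-at-t  : u t ≤ (d ∸ 1) * w t
      sum-w       : sum w ≡ ∣ ∁ U ∣
      sum-u       : sum u ≡ ∣ U′ ∣

  Invariant-initial : Invariant (initial G)
  Invariant-initial = record
    { w = indicator (∁ U) ; u = indicator U′
    ; tokens≤cups = tokens≤cups ; lone-cup = lone-cup ; bound-at-t = bound-at-t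
    ; sum-w = sum-indicator (∁ U) ; sum-u = sum-indicator U′
    }
    where
    tokens≤cups : ∀ z → indicator (∁ U) z + indicator U′ z ≤ 1
    tokens≤cups z with z ∈? ∁ U | z ∈? U′
    ... | yes z∈∁U | yes z∈U′ = contradiction (proj₁ (U′-far z z∈U′)) (x∈∁p⇒x∉p z∈∁U)
    ... | yes _    | no _     = ≤-refl
    ... | no _     | yes _    = ≤-refl
    ... | no _     | no _     = z≤n

    lone-cup : ∀ z → z ≢ t → LoneCup z 1 (indicator (∁ U) z) (indicator U′ z)
    lone-cup z _ _ _ with z ∈? ∁ U | z ∈? U′
    lone-cup z _ _ () | yes _ | _
    lone-cup z _ _ _  | no z∉∁U | yes z∈U′ = refl , x∉∁p⇒x∈p z∉∁U , inj₂ z∈U′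
    lone-cup z _ _ _  | no z∉∁U | no _     = refl , x∉∁p⇒x∈p z∉∁U , inj₁ refl

    bound-at-t : indicator U′ t ≤ (d ∸ 1) * indicator (∁ U) t
    bound-at-t with t ∈? U′
    ... | yes t∈U′ = contradiction t∈U′ t∉U′
    ... | no _     = z≤n

  module _ {c : Config G} (I : Invariant c) where
    open Invariant I

    arrival-bound : ∀ {x} → x ≢ t → 1 ≤ c x → Dist G x t (c x) → u x ≤ (d ∸ 1) * w x
    arrival-bound {x} x≢t 1≤cx dist with w x in wx≡
    ... | zero = subst (_≤ _) (sym (lone-arrival (lone-cup x x≢t 1≤cx wx≡))) z≤n
      where
      lone-arrival : c x ≡ 1 × x ∈ U × (u x ≡ 0 ⊎ x ∈ U′) → u x ≡ 0
      lone-arrival (_    , _ , inj₁ ux≡0) = ux≡0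
      lone-arrival (cx≡1 , _ , inj₂ x∈U′) =
        contradiction (subst (2 ≤_) cx≡1 (U′-dist x∈U′ dist)) λ { (s≤s ()) }
    ... | suc k = m+n≤o⇒m≤[o∸1]*n (u x) (suc k) d (subst (λ v → u x + v ≤ d) wx≡ tokens≤d)
      where
      tokens≤d : u x + w x ≤ d
      tokens≤d = ≤-trans (≤-reflexive (+-comm (u x) (w x)))
                         (≤-trans (tokens≤cups x) (d-bound x (c x) dist))

    no-lone-merge : ∀ {x y} → x ≢ t → y ≢ t → 1 ≤ c x → 1 ≤ c y → Dist G x y (c x) →
                    w x ≡ 0 → w y ≡ 0 → ⊥
    no-lone-merge {x} {y} x≢t y≢t 1≤cx 1≤cy (walk , _) wx≡0 wy≡0 =
      let (cx≡1 , x∈U , _) = lone-cup x x≢t 1≤cx wx≡0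
          (_    , y∈U , _) = lone-cup y y≢t 1≤cy wy≡0
      in  contradiction (trans (sym (walk₁⇒adj G (subst (Walk G x y) cx≡1 walk)))
                               (U-independent x y x∈U y∈U))
                        λ ()

  Invariant-step : ∀ {c c′ x y} → Invariant c → x ≢ y → 1 ≤ c x → 1 ≤ c y →
                   Dist G x y (c x) → Transfer x y c c′ → x ≢ t → Invariant c′
  Invariant-step {c′ = c′} {x = x} {y = y} I x≢y 1≤cx 1≤cy dist c-transfer@(c′x≡0 , _ , c′z) x≢t = record
    { w = w′ ; u = u′
    ; tokens≤cups = Transfer-mono-≤ tokens≤cups
                      (Transfer-+ (transfer-Transfer w x≢y) (transfer-Transfer u x≢y)) c-transfer
    ; lone-cup = lone-cup′ ; bound-at-t = bound-at-t′
    ; sum-w = trans (sum-transfer x y w) sum-w ; sum-u = trans (sum-transfer x y u) sum-u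
    }
    where
    open Invariant I
    w′ u′ : Vector ℕ n
    w′ = transfer x y w
    u′ = transfer x y u

    lone-cup′ : ∀ z → z ≢ t → LoneCup z (c′ z) (w′ z) (u′ z)
    lone-cup′ z z≢t with z ≟ x | z ≟ y
    ... | yes refl | _ = λ 1≤c′x _ → contradiction c′x≡0 (>⇒≢ 1≤c′x)
    ... | no _ | yes refl = λ _ w′z≡0 →
      let wz+wx≡0 = trans (sym (transfer-target w x≢y)) w′z≡0
      in  ⊥-elim (no-lone-merge I x≢t z≢t 1≤cx 1≤cy dist
                    (m+n≡0⇒n≡0 (w z) wz+wx≡0) (m+n≡0⇒m≡0 (w z) wz+wx≡0))
    ... | no z≢x | no z≢y
      rewrite c′z z z≢x z≢y | transfer-others w z z≢x z≢y | transfer-others u z z≢x z≢y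
      = lone-cup z z≢t

    bound-at-t′ : u′ t ≤ (d ∸ 1) * w′ t
    bound-at-t′ with y ≟ t
    ... | yes refl = begin
      u′ y                             ≡⟨ transfer-target u x≢y ⟩
      u y + u x                        ≤⟨ +-mono-≤ bound-at-t (arrival-bound I x≢t 1≤cx dist) ⟩
      (d ∸ 1) * w y + (d ∸ 1) * w x    ≡⟨ sym (*-distribˡ-+ (d ∸ 1) (w y) (w x)) ⟩
      (d ∸ 1) * (w y + w x)            ≡⟨ cong ((d ∸ 1) *_) (sym (transfer-target w x≢y)) ⟩
      (d ∸ 1) * w′ y                   ∎
      where open ≤-Reasoning
    ... | no y≢t = subst₂ _≤_ (sym (transfer-others u t t≢x t≢y))
                              (cong ((d ∸ 1) *_) (sym (transfer-others w t t≢x t≢y)))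
                              bound-at-t
      where
      t≢x : t ≢ x
      t≢x = x≢t ∘ sym
      t≢y : t ≢ y
      t≢y = y≢t ∘ sym

  Invariant⇒bound : ∀ {c} → Invariant c → (∀ z → z ≢ t → c z ≡ 0) → ∣ U′ ∣ ≤ (d ∸ 1) * ∣ ∁ U ∣
  Invariant⇒bound I all-on-t = begin
    ∣ U′ ∣             ≡⟨ sym sum-u ⟩
    sum u              ≡⟨ sum-supported-at t (λ z z≢t → m+n≡0⇒n≡0 (w z) (no-tokens-off-t z z≢t)) ⟩
    u t                ≤⟨ bound-at-t ⟩
    (d ∸ 1) * w t      ≡⟨ cong ((d ∸ 1) *_) (sym w-sum) ⟩
    (d ∸ 1) * sum w    ≡⟨ cong ((d ∸ 1) *_) sum-w ⟩
    (d ∸ 1) * ∣ ∁ U ∣  ∎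
    where
    open Invariant I
    open ≤-Reasoning
    no-tokens-off-t : ∀ z → z ≢ t → w z + u z ≡ 0
    no-tokens-off-t z z≢t = n≤0⇒n≡0 (subst (_ ≤_) (all-on-t z z≢t) (tokens≤cups z))
    w-sum : sum w ≡ w t
    w-sum = sum-supported-at t (λ z z≢t → m+n≡0⇒m≡0 (w z) (no-tokens-off-t z z≢t))

  Stranded : Config G → Set
  Stranded c = c t ≡ 0 × ∃ λ z → 1 ≤ c z

  Stranded⇒¬all-on-t : ∀ {c} → Stranded c → ¬ (∀ z → z ≢ t → c z ≡ 0)
  Stranded⇒¬all-on-t (ct≡0 , z , 1≤cz) all-on-t with z ≟ t
  ... | yes refl = contradiction ct≡0 (>⇒≢ 1≤cz)
  ... | no z≢t   = contradiction (all-on-t z z≢t) (>⇒≢ 1≤cz)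

  State : Config G → Set
  State c = Invariant c ⊎ Stranded c

  State-step : ∀ {c c′} → State c → Move G c c′ → State c′
  State-step (inj₂ (ct≡0 , _)) m = inj₂ (Move-keeps-empty G m ct≡0 , Move-target-nonempty G m)
  State-step (inj₁ I) m@(x , _ , x≢y , 1≤cx , 1≤cy , dist , c-transfer) with x ≟ t
  ... | yes refl = inj₂ (proj₁ c-transfer , Move-target-nonempty G m)
  ... | no x≢t   = inj₁ (Invariant-step I x≢y 1≤cx 1≤cy dist c-transfer x≢t)

  State-star : ∀ {c c′} → State c → Star (Move G) c c′ → State c′
  State-star s ε        = s
  State-star s (m ◅ ms) = State-star (State-step s m) ms

  stackable⇒bound : Stackable G t → ∣ U′ ∣ ≤ (d ∸ 1) * ∣ ∁ U ∣
  stackable⇒bound (_ , moves , all-on-t) with State-star (inj₁ Invariant-initial) moves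
  ... | inj₁ I        = Invariant⇒bound I all-on-t
  ... | inj₂ stranded = contradiction all-on-t (Stranded⇒¬all-on-t stranded)

lemma4p1 : ∀ {n : ℕ} (G : Graph n) → Connected G → (t : Fin n)
    → (U : Subset n) → (∀ x y → x ∈ U → y ∈ U → adj G x y ≡ false)
    → (U′ : Subset n) → (∀ x → (x ∈ U′) ⇔ (x ∈ U × (∃ λ r → Dist G x t r × 2 ≤ r)))
    → (d : ℕ) → (∀ x r → Dist G x t r → r ≤ d) → (∃ λ x → Dist G x t d)
    → (d ∸ 1) * ∣ ∁ U ∣ < ∣ U′ ∣
    → ¬ Stackable G t
lemma4p1 G _ t U U-independent U′ U′-spec d d-bound _ too-many stackable =
  <⇒≱ too-many (stackable⇒bound G t U U-independent U′ (λ x → Equivalence.to (U′-spec x)) d d-bound stackable)
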